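{- Let $n\geq 3$, $\vec{x}\in\mathbb{Z}^n$ and $m\in\{1,\ldots,n-2\}$. If $k(\vec{x})\geq m-1$, $l(\vec{x})\geq m-2$, $\vec{x}(m)=\vec{x}(m+2)$ and $\vec{x}(m)\geq\vec{x}(m+1)$, then $f(\vec{x})=\vec{x}(m)$.
   Context: For $\vec{x}\in\mathbb{Z}^n$ write $\vec{x}(i)$ for its $i$-th entry. $k(\vec{x})=n$ if $\vec{x}(1)>\cdots>\vec{x}(n)$, otherwise the least $k$ with $\vec{x}(k)\leq\vec{x}(k+1)$. $l(\vec{x})$ is the least $l$ with $1\leq l<k(\vec{x})$, $\vec{x}(l)>\vec{x}(l+1)+1$ and $\vec{x}(l+1)=\vec{x}(l+2)+1$ if it exists, otherwise $k(\vec{x})-1$. The function $f:\mathbb{Z}^n\to\mathbb{Z}$ (Bailey–Cowles) is given by: $f(\vec{x})=\vec{x}(1)$ if $k(\vec{x})=n$, and $f(\vec{x})=\max\{\vec{x}(l(\vec{x})+2),\vec{x}(k(\vec{x})+1)\}$ if $k(\vec{x})<n$. -}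

module Defs where

open import Data.Nat as ℕ using (ℕ; zero; suc; _∸_)
open import Data.Integer as ℤ using (ℤ; _+_; _≤?_; _<?_; _⊔_; 0ℤ; 1ℤ)
open import Data.Vec using (Vec; []; _∷_)
open import Data.Bool using (Bool; true; false; if_then_else_; _∧_)
open import Relation.Nullary.Decidable using (⌊_⌋)

-- 1-based entry x(i) of a vector; returns 0 for indices outside 1..n
-- (only ever used at valid indices where it matters).
_!_ : ∀ {n} → Vec ℤ n → ℕ → ℤ
[]       ! _             = 0ℤ
(a ∷ _)  ! 1             = a
(_ ∷ xs) ! suc (suc i)   = xs ! suc i
(_ ∷ _)  ! zero          = 0ℤ

search : (ℕ → Bool) → (s r d : ℕ) → ℕ
search P s zero    d = d
search P s (suc r) d = if P s then s else search P (suc s) r d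

kk : ∀ {n} → Vec ℤ n → ℕ
kk {n} x = search (λ i → ⌊ (x ! i) ≤? (x ! suc i) ⌋) 1 (n ∸ 1) n

ll : ∀ {n} → Vec ℤ n → ℕ
ll x = search (λ i → ⌊ ((x ! suc i) + 1ℤ) <? (x ! i) ⌋
                   ∧ ⌊ (x ! suc i) ℤ.≟ ((x ! suc (suc i)) + 1ℤ) ⌋)
              1 (kk x ∸ 1) (kk x ∸ 1)

ff : ∀ {n} → Vec ℤ n → ℤ
ff {n} x = if ⌊ kk x ℕ.≟ n ⌋ then x ! 1
           else ((x ! (ll x ℕ.+ 2)) ⊔ (x ! (kk x ℕ.+ 1)))

module Submission where

open import Defs
open import Data.Nat using (ℕ; _≤_; _≥_; _∸_; _+_)
open import Data.Integer using (ℤ) renaming (_≥_ to _≥ℤ_)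
open import Data.Vec using (Vec)
open import Relation.Binary.PropositionalEquality using (_≡_)

open import Data.Nat as ℕ using (zero; suc; _<_; z≤n; s≤s)
open import Data.Nat.Properties
  using (≤-refl; ≤-reflexive; ≤-trans; <-≤-trans; ≤-<-trans; <⇒≤; <⇒≱; <⇒≢; ≤-pred;
         m≤n⇒m<n∨m≡n; m<m+n; m≤m+n; +-suc; +-comm; +-assoc; +-identityʳ; +-monoˡ-≤;
         +-monoʳ-≤; +-cancelˡ-≤; +-cancelʳ-≡; ∸-monoˡ-≤; m+n∸n≡m; m≤n+m∸n; m+[n∸m]≡n;
         m≤n⇒∃[o]m+o≡n; m≤o∸n⇒m+n≤o)
open import Data.Integer as ℤ using (_⊔_)
open import Data.Integer.Properties as ℤₚ using (i≤j⇒i⊔j≡j)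
open import Data.Bool using (true; false)
open import Data.Empty using (⊥-elim)
open import Data.Product using (_,_)
open import Data.Sum using (_⊎_; inj₁; inj₂)
open import Relation.Nullary using (yes; no)
open import Relation.Nullary.Decidable using (⌊_⌋)
open import Relation.Binary.PropositionalEquality
  using (refl; sym; trans; cong; subst; subst₂; _≢_; module ≡-Reasoning)

-- x(m+1) ≤ x(m) = x(m+2) is an ascent at m+1, so k ≤ m+1 < n and
-- f = max(x(l+2), x(k+1)). The hypotheses put both l+2 and k+1 in the window
-- {m, m+1, m+2}, on which x is bounded by x(m); and x(k+1) = x(m) exactly,
-- since k = m would make x(m) ≤ x(m+1) an ascent.

search-≤-witness : ∀ P s r d {j} → P j ≡ true → s ≤ j → j < s + r → search P s r d ≤ j
search-≤-witness P s zero    d {j} Pj s≤j j<s+0 =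
  ⊥-elim (<⇒≱ (subst (j <_) (+-identityʳ s) j<s+0) s≤j)
search-≤-witness P s (suc r) d {j} Pj s≤j j<s+r with P s in Ps
... | true  = s≤j
... | false with m≤n⇒m<n∨m≡n s≤j
...   | inj₁ s<j  = search-≤-witness P (suc s) r d Pj s<j (subst (j <_) (+-suc s r) j<s+r)
...   | inj₂ refl with trans (sym Ps) Pj
...     | ()

search-default⊎satisfies : ∀ P s r d → search P s r d ≡ d ⊎ P (search P s r d) ≡ true
search-default⊎satisfies P s zero    d = inj₁ refl
search-default⊎satisfies P s (suc r) d with P s in Ps
... | true  = inj₂ Ps
... | false = search-default⊎satisfies P (suc s) r d

search-≤-default : ∀ P s r d → s + r ≤ suc d → search P s r d ≤ d
search-≤-default P s zero    d _ = ≤-refl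
search-≤-default P s (suc r) d s+r≤d with P s
... | true  = ≤-pred (<-≤-trans (m<m+n s (s≤s z≤n)) s+r≤d)
... | false = search-≤-default P (suc s) r d (subst (_≤ suc d) (+-suc s r) s+r≤d)

module _ {n : ℕ} (x : Vec ℤ n) where

  kk-≤-ascent : ∀ {i} → 1 ≤ i → i < n → x ! i ℤ.≤ x ! suc i → kk x ≤ i
  kk-≤-ascent {i} 1≤i i<n xᵢ≤xᵢ₊₁ =
    search-≤-witness _ 1 (n ∸ 1) n isAscent 1≤i (subst (i <_) (sym (m+[n∸m]≡n 1≤n)) i<n)
    where
    1≤n : 1 ≤ n
    1≤n = ≤-trans 1≤i (<⇒≤ i<n)
    isAscent : ⌊ x ! i ℤ.≤? x ! suc i ⌋ ≡ true
    isAscent with x ! i ℤ.≤? x ! suc i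
    ... | yes _  = refl
    ... | no  ¬p = ⊥-elim (¬p xᵢ≤xᵢ₊₁)

  kk-ascent : kk x ≢ n → x ! kk x ℤ.≤ x ! suc (kk x)
  kk-ascent k≢n with search-default⊎satisfies (λ i → ⌊ x ! i ℤ.≤? x ! suc i ⌋) 1 (n ∸ 1) n
  ... | inj₁ k≡n    = ⊥-elim (k≢n k≡n)
  ... | inj₂ ascent with x ! kk x ℤ.≤? x ! suc (kk x)
  ...   | yes xₖ≤xₖ₊₁ = xₖ≤xₖ₊₁
  ...   | no _ with ascent
  ...     | ()

  ll≤kk∸1 : ll x ≤ kk x ∸ 1
  ll≤kk∸1 = search-≤-default _ 1 (kk x ∸ 1) (kk x ∸ 1) ≤-refl

  ff-when-kk≢n : kk x ≢ n → ff x ≡ x ! (ll x + 2) ⊔ x ! (kk x + 1)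
  ff-when-kk≢n k≢n with kk x ℕ.≟ n
  ... | yes k≡n = ⊥-elim (k≢n k≡n)
  ... | no _    = refl

m∸n≤o⇒m≤o+n : ∀ m n {o} → m ∸ n ≤ o → m ≤ o + n
m∸n≤o⇒m≤o+n m n {o} m∸n≤o =
  ≤-trans (m≤n+m∸n m n) (≤-trans (+-monoʳ-≤ n m∸n≤o) (≤-reflexive (+-comm n o)))

within-two : ∀ {m i} → m ≤ i → i ≤ m + 2 → i ≡ m ⊎ i ≡ m + 1 ⊎ i ≡ m + 2
within-two {m} m≤i i≤m+2 with m≤n⇒∃[o]m+o≡n m≤i
... | d , refl with +-cancelˡ-≤ m d 2 i≤m+2
...   | z≤n           = inj₁ (+-identityʳ m)
...   | s≤s z≤n       = inj₂ (inj₁ refl)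
...   | s≤s (s≤s z≤n) = inj₂ (inj₂ refl)

module _ {n : ℕ} (x : Vec ℤ n) {m : ℕ}
         (xₘ≡xₘ₊₂ : x ! m ≡ x ! (m + 2)) (xₘ₊₁≤xₘ : x ! (m + 1) ℤ.≤ x ! m) where

  !-≤-on-window : ∀ {i} → m ≤ i → i ≤ m + 2 → x ! i ℤ.≤ x ! m
  !-≤-on-window m≤i i≤m+2 with within-two m≤i i≤m+2
  ... | inj₁ refl        = ℤₚ.≤-refl
  ... | inj₂ (inj₁ refl) = xₘ₊₁≤xₘ
  ... | inj₂ (inj₂ refl) = ℤₚ.≤-reflexive (sym xₘ≡xₘ₊₂)

  ascent-at-m+1 : x ! (m + 1) ℤ.≤ x ! suc (m + 1)
  ascent-at-m+1 =
    subst (λ j → x ! (m + 1) ℤ.≤ x ! j) (+-suc m 1) (subst (x ! (m + 1) ℤ.≤_) xₘ≡xₘ₊₂ xₘ₊₁≤xₘ)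

  !-kk+1≡-on-window : kk x ≢ n → m ≤ kk x + 1 → kk x ≤ m + 1 → x ! (kk x + 1) ≡ x ! m
  !-kk+1≡-on-window kk≢n m≤kk+1 kk≤m+1
    with within-two m≤kk+1 (subst (kk x + 1 ≤_) (+-assoc m 1 1) (+-monoˡ-≤ 1 kk≤m+1))
  ... | inj₁ kk+1≡m           = cong (x !_) kk+1≡m
  ... | inj₂ (inj₂ kk+1≡m+2) = trans (cong (x !_) kk+1≡m+2) (sym xₘ≡xₘ₊₂)
  ... | inj₂ (inj₁ kk+1≡m+1) = ℤₚ.≤-antisym
          (subst (λ i → x ! i ℤ.≤ x ! m) (sym kk+1≡m+1) xₘ₊₁≤xₘ) xₘ≤x[kk+1]
    where
    kk≡m : kk x ≡ m
    kk≡m = +-cancelʳ-≡ 1 (kk x) m kk+1≡m+1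
    xₘ≤x[kk+1] : x ! m ℤ.≤ x ! (kk x + 1)
    xₘ≤x[kk+1] = subst₂ (λ i j → x ! i ℤ.≤ x ! j) kk≡m (+-comm 1 (kk x)) (kk-ascent x kk≢n)

lemma3p8 : (n : ℕ) → 3 ≤ n → (x : Vec ℤ n) → (m : ℕ) → 1 ≤ m → m ≤ n ∸ 2 →
    kk x ≥ m ∸ 1 → ll x ≥ m ∸ 2 → x ! m ≡ x ! (m + 2) → x ! m ≥ℤ x ! (m + 1) →
    ff x ≡ x ! m
lemma3p8 n 3≤n x m 1≤m m≤n∸2 kk≥m∸1 ll≥m∸2 xₘ≡xₘ₊₂ xₘ₊₁≤xₘ = begin
  ff x                             ≡⟨ ff-when-kk≢n x kk≢n ⟩
  x ! (ll x + 2) ⊔ x ! (kk x + 1)  ≡⟨ cong (x ! (ll x + 2) ⊔_) x[kk+1]≡xₘ ⟩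
  x ! (ll x + 2) ⊔ x ! m           ≡⟨ i≤j⇒i⊔j≡j x[ll+2]≤xₘ ⟩
  x ! m                            ∎
  where
  open ≡-Reasoning

  m+1<n : m + 1 < n
  m+1<n = subst (_≤ n) (+-suc m 1) (m≤o∸n⇒m+n≤o m (≤-trans (s≤s (s≤s z≤n)) 3≤n) m≤n∸2)

  kk≤m+1 : kk x ≤ m + 1
  kk≤m+1 = kk-≤-ascent x (≤-trans 1≤m (m≤m+n m 1)) m+1<n
             (ascent-at-m+1 x xₘ≡xₘ₊₂ xₘ₊₁≤xₘ)

  kk≢n : kk x ≢ n
  kk≢n = <⇒≢ (≤-<-trans kk≤m+1 m+1<n)

  ll≤m : ll x ≤ m
  ll≤m = ≤-trans (ll≤kk∸1 x) (subst (kk x ∸ 1 ≤_) (m+n∸n≡m m 1) (∸-monoˡ-≤ 1 kk≤m+1))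

  x[ll+2]≤xₘ : x ! (ll x + 2) ℤ.≤ x ! m
  x[ll+2]≤xₘ =
    !-≤-on-window x xₘ≡xₘ₊₂ xₘ₊₁≤xₘ (m∸n≤o⇒m≤o+n m 2 ll≥m∸2) (+-monoˡ-≤ 2 ll≤m)

  x[kk+1]≡xₘ : x ! (kk x + 1) ≡ x ! m
  x[kk+1]≡xₘ =
    !-kk+1≡-on-window x xₘ≡xₘ₊₂ xₘ₊₁≤xₘ kk≢n (m∸n≤o⇒m≤o+n m 1 kk≥m∸1) kk≤m+1
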